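{- For every integer $k \geq 1$, the chromatic number of the twincut graph $G_k$ satisfies $\chi(G_k) = k$.
   Context: A structured tree is a pair $(T,g)$ where $T$ is a rooted tree and $g$ is a function defined on the internal (non-leaf) nodes $v$ of $T$ such that $g(v)$ is a graph whose vertex set is the set of children of $v$ in $T$. A branch of $T$ is a path in $T$ from the root to a leaf. The realization $R(T,g)$ is the graph with vertex set $V(T)\cup B$, where $B$ is a set of new vertices in bijection with the branches of $T$ (called branch vertices). Its edges are: all pairs $uv$ where $u,v$ are children of a common internal node $z$ and $uv$ is an edge of $g(z)$; and, for each branch vertex $b$, all pairs $bw$ with $w$ a node of $T$ lying on the branch $b$. The edges of $T$ itself are not edges of $R(T,g)$. (If $T$ is a single root vertex, $R(T,g)=K_2$.) The twincut graphs $G_1,G_2,\dots$ are defined inductively: $G_1$ is the one-vertex graph; for $k\ge 2$, $G_k=R(T_k,g_k)$ where $T_k$ is the rooted tree with $k-1$ levels (the root is at level $1$) in which every node $v$ at level $i<k-1$ has exactly $|V(G_{i+1})|$ children and $g_k(v)$ is a copy of $G_{i+1}$ on these children (nodes at level $k-1$ are leaves). -}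

module Defs where

open import Data.Nat using (ℕ; zero; suc; _≤_)
open import Data.Fin using (Fin)
open import Data.List using (List; []; _∷_; _++_; [_])
open import Data.Unit using (⊤; tt)
open import Data.Empty using (⊥)
open import Data.Sum using (_⊎_; inj₁; inj₂)
open import Data.Product using (Σ; _×_; _,_)
open import Relation.Binary.PropositionalEquality using (_≡_)
open import Relation.Nullary using (¬_)

record Graph : Set₁ where
  field
    V : Set
    E : V → V → Set
open Graph public

-- A list  gs = [H₁, …, Hₘ]  describes a rooted tree with m+1 levels in
-- which every node at level i ≤ m has |V(Hᵢ)| children (indexed by V(Hᵢ)),
-- and g(v) is the copy of Hᵢ on these children.  Nodes at level m+1 are
-- leaves.  A node is a root, or a step to a child followed by a node of
-- the subtree below that child (which has shape gs minus its head).

Node : List Graph → Set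
Node []       = ⊤
Node (h ∷ gs) = ⊤ ⊎ (V h × Node gs)

root : (gs : List Graph) → Node gs
root []      = tt
root (_ ∷ _) = inj₁ tt

-- Leaves (equivalently: branches = root-to-leaf paths).
Leaf : List Graph → Set
Leaf []       = ⊤
Leaf (h ∷ gs) = V h × Leaf gs

OnBranch : (gs : List Graph) → Node gs → Leaf gs → Set
OnBranch []       _               _        = ⊤
OnBranch (h ∷ gs) (inj₁ _)        _        = ⊤
OnBranch (h ∷ gs) (inj₂ (x , n)) (y , l)  = (x ≡ y) × OnBranch gs n l

IsRoot : (gs : List Graph) → Node gs → Set
IsRoot []       _        = ⊤
IsRoot (h ∷ gs) (inj₁ _) = ⊤
IsRoot (h ∷ gs) (inj₂ _) = ⊥

-- Two nodes are children of a common internal node z and adjacent in g(z).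
Sib : (gs : List Graph) → Node gs → Node gs → Set
Sib []       _               _              = ⊥
Sib (h ∷ gs) (inj₁ _)        _              = ⊥
Sib (h ∷ gs) (inj₂ _)        (inj₁ _)       = ⊥
Sib (h ∷ gs) (inj₂ (x , n)) (inj₂ (y , m)) =
  (IsRoot gs n × IsRoot gs m × E h x y)
  ⊎ (x ≡ y × Sib gs n m)

-- The realization R(T,g): tree nodes plus one branch vertex per branch.
Realization : List Graph → Graph
Realization gs = record { V = Node gs ⊎ Leaf gs ; E = edge }
  where
  edge : Node gs ⊎ Leaf gs → Node gs ⊎ Leaf gs → Set
  edge (inj₁ n) (inj₁ m) = Sib gs n m
  edge (inj₁ n) (inj₂ b) = OnBranch gs n b
  edge (inj₂ b) (inj₁ n) = OnBranch gs n b
  edge (inj₂ _) (inj₂ _) = ⊥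

G₁ : Graph
G₁ = record { V = ⊤ ; E = λ _ _ → ⊥ }

-- prev m = [G₂, …, G_{m+1}]; then G_{m+2} = R(prev m), since T_{m+2}
-- has m+1 levels and nodes at level i have |V(G_{i+1})| children
-- carrying a copy of G_{i+1}.
prev : ℕ → List Graph
prev zero    = []
prev (suc m) = prev m ++ [ Realization (prev m) ]

-- twincut k = G_k for k ≥ 1 (twincut 0 is an irrelevant dummy).
twincut : ℕ → Graph
twincut zero          = G₁
twincut (suc zero)    = G₁
twincut (suc (suc m)) = Realization (prev m)

Colourable : Graph → ℕ → Set
Colourable G k =
  Σ (V G → Fin k) λ c → ∀ u v → E G u v → ¬ (c u ≡ c v)

ChromaticNumber : Graph → ℕ → Set
ChromaticNumber G k = Colourable G k × (∀ j → Colourable G j → k ≤ j)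

-- Upper bound: colour each tree node by a proper colouring of the graph g(parent), carried
-- down level by level, and give every branch vertex one fresh colour.  If G₂, …, G_{k-1}
-- are (k-1)-colourable, this properly colours G_k with k colours.
--
-- Lower bound: in a proper colouring of R(T,g), walk down from the root, keeping the set S
-- of colours seen on the path so far.  Every branch vertex below the current node avoids S.
-- If all children of the current node v used colours of S ∪ {colour of v}, then g(v) would
-- be coloured with |S| + 1 colours, which is too few when χ(g(v)) exceeds the depth of v;
-- so some child has a new colour and the walk continues.  At a leaf, the leaf and its branch
-- vertex add two more colours to the depth-many colours seen on the path.

module Submission where

open import Defs
open import Data.Nat using (ℕ; zero; suc; _+_; _≤_; _≤?_; s≤s; z≤n)
open import Data.Nat.Properties using (+-suc; +-identityʳ; +-comm; <-irrefl; n≤1+n)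
open import Data.Fin using (Fin; inject≤; inject₁; fromℕ) renaming (zero to fzero; suc to fsuc)
open import Data.Fin.Properties using (_≟_; injective⇒≤; inject≤-injective; inject₁-injective; fromℕ≢inject₁)
open import Data.List using (List; []; _∷_; _++_; [_]; length; lookup)
open import Data.List.Properties using (length-++)
open import Data.List.Relation.Unary.All as All using (All; []; _∷_)
open import Data.List.Relation.Unary.All.Properties using (¬Any⇒All¬; ∷ʳ⁺)
open import Data.List.Relation.Unary.Any using (here; there; index)
open import Data.List.Relation.Unary.Any.Properties using (lookup-index)
open import Data.List.Relation.Unary.Unique.Propositional using (Unique; []; _∷_)
open import Data.List.Membership.Propositional using (_∈_; _∉_)
import Data.List.Membership.DecPropositional as DecMembership
open import Data.List.Membership.Propositional.Properties using (∈-lookup)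
open import Data.Unit using (⊤; tt)
open import Data.Empty using (⊥-elim)
open import Data.Sum using (inj₁; inj₂)
open import Data.Product using (_×_; _,_)
open import Function using (_∘_)
open import Relation.Binary.PropositionalEquality using (_≡_; _≢_; refl; sym; trans; cong; subst)
open import Relation.Nullary using (¬_)
open import Relation.Nullary.Decidable using (decidable-stable)

Proper : ∀ {k} (G : Graph) → (V G → Fin k) → Set
Proper G c = ∀ u v → E G u v → ¬ (c u ≡ c v)

colourable-mono : ∀ {G a b} → a ≤ b → Colourable G a → Colourable G b
colourable-mono a≤b (c , proper) =
  (λ v → inject≤ (c v) a≤b) , λ u v e → proper u v e ∘ inject≤-injective a≤b a≤b _ _

ChromaticAtLeast : Graph → ℕ → Set
ChromaticAtLeast G k = ∀ j → Colourable G j → k ≤ j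

ChromaticNumber-G₁ : ChromaticNumber G₁ 1
ChromaticNumber-G₁ = ((λ _ → fzero) , λ _ _ ()) , at-least
  where
  at-least : ChromaticAtLeast G₁ 1
  at-least zero    (c , _) with () ← c tt
  at-least (suc j) _       = s≤s z≤n

Unique⇒lookup-injective : ∀ {j} {xs : List (Fin j)} → Unique xs →
                          ∀ a b → lookup xs a ≡ lookup xs b → a ≡ b
Unique⇒lookup-injective (_ ∷ _)      fzero    fzero    _  = refl
Unique⇒lookup-injective (x≢ ∷ _)     fzero    (fsuc b) eq = ⊥-elim (All.lookup x≢ (∈-lookup b) eq)
Unique⇒lookup-injective (x≢ ∷ _)     (fsuc a) fzero    eq = ⊥-elim (All.lookup x≢ (∈-lookup a) (sym eq))
Unique⇒lookup-injective (_ ∷ unique) (fsuc a) (fsuc b) eq =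
  cong fsuc (Unique⇒lookup-injective unique a b eq)

Unique⇒length≤ : ∀ {j} {xs : List (Fin j)} → Unique xs → length xs ≤ j
Unique⇒length≤ unique = injective⇒≤ (Unique⇒lookup-injective unique _ _)

∉⇒Unique-∷ : ∀ {j} {x : Fin j} {xs} → x ∉ xs → Unique xs → Unique (x ∷ xs)
∉⇒Unique-∷ {xs = xs} x∉xs unique = ¬Any⇒All¬ xs x∉xs ∷ unique

colourable-by-palette : ∀ {G j} (c : V G → Fin j) → Proper G c →
                        (xs : List (Fin j)) → (∀ v → c v ∈ xs) → Colourable G (length xs)
colourable-by-palette c proper xs c∈xs = (λ v → index (c∈xs v)) , λ u v e eq →
  proper u v e (trans (lookup-index (c∈xs u)) (trans (cong (lookup xs) eq) (sym (lookup-index (c∈xs v)))))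

treeColouring : ∀ {n} gs → All (λ h → Colourable h n) gs → Fin n → Node gs → Fin n
treeColouring []       _              rootColour _              = rootColour
treeColouring (_ ∷ _)  _              rootColour (inj₁ _)       = rootColour
treeColouring (_ ∷ gs) ((c , _) ∷ cs) _          (inj₂ (x , v)) = treeColouring gs cs (c x) v

treeColouring-root : ∀ {n} gs (cs : All (λ h → Colourable h n) gs) p v →
                     IsRoot gs v → treeColouring gs cs p v ≡ p
treeColouring-root []      _ _ _        _ = refl
treeColouring-root (_ ∷ _) _ _ (inj₁ _) _ = refl

treeColouring-proper : ∀ {n} gs (cs : All (λ h → Colourable h n) gs) p u v →
                       Sib gs u v → treeColouring gs cs p u ≢ treeColouring gs cs p v
treeColouring-proper (_ ∷ gs) ((c , proper) ∷ cs) _ (inj₂ (x , u)) (inj₂ (y , v))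
                     (inj₁ (u-root , v-root , e)) eq =
  proper x y e (trans (sym (treeColouring-root gs cs (c x) u u-root))
               (trans eq (treeColouring-root gs cs (c y) v v-root)))
treeColouring-proper (_ ∷ gs) ((c , _) ∷ cs) _ (inj₂ (x , u)) (inj₂ (.x , v))
                     (inj₂ (refl , sib)) =
  treeColouring-proper gs cs (c x) u v sib

realization-colourable : ∀ {n} gs → All (λ h → Colourable h (suc n)) gs →
                         Colourable (Realization gs) (suc (suc n))
realization-colourable {n} gs cs = colour , proper
  where
  colour : V (Realization gs) → Fin (suc (suc n))
  colour (inj₁ v) = inject₁ (treeColouring gs cs fzero v)
  colour (inj₂ _) = fromℕ (suc n)

  proper : Proper (Realization gs) colour
  proper (inj₁ u) (inj₁ v) sib = treeColouring-proper gs cs fzero u v sib ∘ inject₁-injective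
  proper (inj₁ _) (inj₂ _) _   = fromℕ≢inject₁ ∘ sym
  proper (inj₂ _) (inj₁ _) _   = fromℕ≢inject₁

ChromaticAtLeastFrom : List Graph → ℕ → Set
ChromaticAtLeastFrom []       _ = ⊤
ChromaticAtLeastFrom (h ∷ gs) k = ChromaticAtLeast h k × ChromaticAtLeastFrom gs (suc k)

root-isRoot : ∀ gs → IsRoot gs (root gs)
root-isRoot []      = tt
root-isRoot (_ ∷ _) = tt

module Subtree (h : Graph) (gs : List Graph) where

  rootChild : V h → V (Realization (h ∷ gs))
  rootChild x = inj₁ (inj₂ (x , root gs))

  rootChild-edge : ∀ {x y} → E h x y → E (Realization (h ∷ gs)) (rootChild x) (rootChild y)
  rootChild-edge e = inj₁ (root-isRoot gs , root-isRoot gs , e)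

  below : V h → V (Realization gs) → V (Realization (h ∷ gs))
  below x (inj₁ v) = inj₁ (inj₂ (x , v))
  below x (inj₂ l) = inj₂ (x , l)

  below-edge : ∀ x u v → E (Realization gs) u v → E (Realization (h ∷ gs)) (below x u) (below x v)
  below-edge x (inj₁ _) (inj₁ _) sib      = inj₂ (refl , sib)
  below-edge x (inj₁ _) (inj₂ _) onBranch = refl , onBranch
  below-edge x (inj₂ _) (inj₁ _) onBranch = refl , onBranch

-- S holds the distinct colours met on the path from the root of the whole tree down to gs.
colours-beyond-palette : ∀ {j} gs (c : V (Realization gs) → Fin j) → Proper (Realization gs) c →
                         (S : List (Fin j)) → Unique S → ChromaticAtLeastFrom gs (2 + length S) →
                         c (inj₁ (root gs)) ∉ S → (∀ l → c (inj₂ l) ∉ S) →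
                         2 + length S + length gs ≤ j
colours-beyond-palette {j} [] c proper S unique _ root∉S branch∉S =
  subst (_≤ j) (cong (2 +_) (sym (+-identityʳ (length S))))
        (Unique⇒length≤ (∉⇒Unique-∷ branch∉ (∉⇒Unique-∷ root∉S unique)))
  where
  branch∉ : c (inj₂ tt) ∉ c (inj₁ tt) ∷ S
  branch∉ (here eq)   = proper (inj₁ tt) (inj₂ tt) tt (sym eq)
  branch∉ (there c∈S) = branch∉S tt c∈S
colours-beyond-palette {j} (h ∷ gs) c proper S unique (h-needs , gs-need) root∉S branch∉S =
  decidable-stable (_ ≤? j) λ too-few →
    <-irrefl refl (h-needs (length S′) (colourable-by-palette (c ∘ rootChild) children-proper S′
                                                               (children∈S′ too-few)))
  where
  open Subtree h gs
  S′ : List (Fin j)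
  S′ = c (inj₁ (root (h ∷ gs))) ∷ S

  children-proper : Proper h (c ∘ rootChild)
  children-proper x y = proper _ _ ∘ rootChild-edge

  branch∉S′ : ∀ x l → c (below x (inj₂ l)) ∉ S′
  branch∉S′ x l (here eq)   = proper (inj₁ (inj₁ tt)) (inj₂ (x , l)) tt (sym eq)
  branch∉S′ x l (there c∈S) = branch∉S (x , l) c∈S

  -- A child with a colour outside S′ lets the walk continue below it.
  children∈S′ : ¬ (2 + length S + length (h ∷ gs) ≤ j) → ∀ x → c (rootChild x) ∈ S′
  children∈S′ too-few x = decidable-stable (DecMembership._∈?_ _≟_ (c (rootChild x)) S′) λ new →
    too-few (subst (_≤ j) (cong (2 +_) (sym (+-suc (length S) (length gs))))
      (colours-beyond-palette gs (c ∘ below x) (λ u v → proper _ _ ∘ below-edge x u v)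
                              S′ (∉⇒Unique-∷ root∉S unique) gs-need new (branch∉S′ x)))

realization-chromaticAtLeast : ∀ gs → ChromaticAtLeastFrom gs 2 →
                               ChromaticAtLeast (Realization gs) (2 + length gs)
realization-chromaticAtLeast gs needs j (c , proper) =
  colours-beyond-palette gs c proper [] [] needs (λ ()) (λ _ ())

ChromaticAtLeastFrom-∷ʳ : ∀ gs {h k} → ChromaticAtLeastFrom gs k →
                          ChromaticAtLeast h (k + length gs) → ChromaticAtLeastFrom (gs ++ [ h ]) k
ChromaticAtLeastFrom-∷ʳ []       {h} {k} _ h-needs = subst (ChromaticAtLeast h) (+-identityʳ k) h-needs , tt
ChromaticAtLeastFrom-∷ʳ (g ∷ gs) {h} {k} (g-needs , gs-need) h-needs =
  g-needs , ChromaticAtLeastFrom-∷ʳ gs gs-need (subst (ChromaticAtLeast h) (+-suc k (length gs)) h-needs)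

length-prev : ∀ m → length (prev m) ≡ m
length-prev zero    = refl
length-prev (suc m) =
  trans (length-++ (prev m)) (trans (+-comm (length (prev m)) 1) (cong suc (length-prev m)))

prev-colourable : ∀ m → All (λ h → Colourable h (suc m)) (prev m)
prev-colourable zero    = []
prev-colourable (suc m) = ∷ʳ⁺ (All.map (colourable-mono (n≤1+n _)) (prev-colourable m))
                              (realization-colourable (prev m) (prev-colourable m))

prev-chromaticAtLeastFrom : ∀ m → ChromaticAtLeastFrom (prev m) 2
prev-chromaticAtLeastFrom zero    = tt
prev-chromaticAtLeastFrom (suc m) =
  ChromaticAtLeastFrom-∷ʳ (prev m) (prev-chromaticAtLeastFrom m)
    (realization-chromaticAtLeast (prev m) (prev-chromaticAtLeastFrom m))

proposition2 : (k : ℕ) → 1 ≤ k → ChromaticNumber (twincut k) k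
proposition2 (suc zero)    _ = ChromaticNumber-G₁
proposition2 (suc (suc m)) _ =
  realization-colourable (prev m) (prev-colourable m) ,
  subst (λ n → ChromaticAtLeast (Realization (prev m)) (2 + n)) (length-prev m)
        (realization-chromaticAtLeast (prev m) (prev-chromaticAtLeastFrom m))
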